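{- Let $G$ be a graph with exactly two components $G_1$ and $G_2$. Then $G$ is niche-realizable if and only if there are nonnegative integers $a_1$, $b_1$, $a_2$, and $b_2$ such that $2a_1+b_1 \le |V(G_1)|$, $2a_2+b_2 \le |V(G_2)|$, $1 \le a_1+b_1 \le 2^{a_2+b_2-1}$, $1 \le a_2+b_2 \le 2^{a_1+b_1-1}$, and for each $i=1,2$, $G_i$ is an expansion of a complete $(a_i+b_i)$-partite graph with $a_i$ partite sets of size two and $b_i$ partite sets of size one.
   Context: All graphs are simple. A bipartite tournament is an orientation of a complete bipartite graph $K_{m,n}$. The niche graph of a digraph $D$ is the graph with vertex set $V(D)$ in which distinct $u,v$ are adjacent iff there is a vertex $w$ with $(u,w),(v,w)\in A(D)$, or with $(w,u),(w,v)\in A(D)$. A graph is niche-realizable if it is the niche graph of some bipartite tournament. For a graph $G$, a vertex $v$ and a finite set $K$ disjoint from $V(G)$, replacing $v$ with a clique formed by $K$ gives the graph with vertex set $(V(G)\cup K)\setminus\{v\}$ and edge set $E(G-v)\cup\{wx : w\ne x, w,x\in K\}\cup\{uw: uv\in E(G), w\in K\}$. A graph is an expansion of $G$ if it is obtained by replacing each vertex of $G$ with a clique (possibly of size one). -}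

module Defs where

open import Data.Nat using (ℕ; _+_; _*_; _∸_; _^_; _≤_)
open import Data.Bool using (Bool; true; false; not)
open import Data.Bool.Properties using () renaming (_≟_ to _≟𝔹_)
open import Data.Fin using (Fin) renaming (_≟_ to _≟F_)
open import Data.Fin.Properties using (all?)
open import Data.List using (List; length; filter)
open import Data.Product using (Σ; ∃; _×_; _,_; proj₁)
open import Data.Sum using (_⊎_; inj₁; inj₂)
open import Data.Sum.Properties using (≡-dec)
open import Data.Empty using (⊥)
open import Relation.Nullary using (¬_)
open import Relation.Nullary.Decidable using (⌊_⌋)
open import Relation.Binary.PropositionalEquality using (_≡_; _≢_)
open import Relation.Binary.Construct.Closure.ReflexiveTransitive using (Star)
open import Function.Definitions using (Surjective)
open import Function.Bundles using (_⇔_)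
open import Data.Empty using (⊥-elim)
open import Relation.Nullary using (Dec; yes; no)
open import Relation.Binary.PropositionalEquality using (refl)
import Relation.Binary.PropositionalEquality as ≡
import Data.List.Base

record Graph (V : Set) : Set where
  field
    E      : V → V → Bool
    sym    : ∀ u v → E u v ≡ E v u
    irrefl : ∀ v → E v v ≡ false

open Graph public

Adj : {V : Set} → Graph V → V → V → Set
Adj G u v = E G u v ≡ true

Connected : {V : Set} → Graph V → Set
Connected {V} G = V × (∀ u v → Star (Adj G) u v)

Induced : {V : Set} → Graph V → (c : V → Bool) → (b : Bool)
        → Graph (Σ V (λ v → c v ≡ b))
Induced G c b = record
  { E      = λ u v → E G (proj₁ u) (proj₁ v)
  ; sym    = λ u v → sym G (proj₁ u) (proj₁ v)
  ; irrefl = λ v → irrefl G (proj₁ v)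
  }

-- G (on Fin n) has exactly two components, namely the vertex classes
-- c ⁻¹(true) and c ⁻¹(false): no edge joins the two classes and each
-- class induces a (nonempty) connected subgraph.
TwoComponents : {n : ℕ} → Graph (Fin n) → (Fin n → Bool) → Set
TwoComponents G c =
  (∀ u v → Adj G u v → c u ≡ c v) ×
  (∀ b → Connected (Induced G c b))

classSize : {n : ℕ} → (Fin n → Bool) → Bool → ℕ
classSize {n} c b = length (filter (λ v → c v ≟𝔹 b) (Data.List.Base.tabulate (λ (i : Fin n) → i)))

-- Expansions: G is an expansion of H (up to isomorphism) iff there is a
-- surjection f : V(G) → V(H) (each vertex x of H is replaced by the
-- nonempty clique f⁻¹(x)) such that distinct u, v are adjacent in G iff
-- f u = f v or f u, f v adjacent in H.
IsExpansionOf : {V W : Set} → Graph V → Graph W → Set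
IsExpansionOf {V} {W} G H =
  Σ (V → W) λ f →
    Surjective _≡_ _≡_ f ×
    (∀ u v → u ≢ v → (Adj G u v ⇔ (f u ≡ f v ⊎ Adj H (f u) (f v))))

-- Complete (a+b)-partite graph with a partite sets of size two and
-- b partite sets of size one.  Vertices: (Fin a × Fin 2) ⊎ Fin b.
MPVertex : ℕ → ℕ → Set
MPVertex a b = (Fin a × Fin 2) ⊎ Fin b

part : {a b : ℕ} → MPVertex a b → Fin a ⊎ Fin b
part (inj₁ (i , _)) = inj₁ i
part (inj₂ j)       = inj₂ j

_≟P_ : {a b : ℕ} → (x y : Fin a ⊎ Fin b) → Dec (x ≡ y)
_≟P_ = ≡-dec _≟F_ _≟F_

private
  ⌊≟⌋-sym : {a b : ℕ} (x y : Fin a ⊎ Fin b) → ⌊ x ≟P y ⌋ ≡ ⌊ y ≟P x ⌋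
  ⌊≟⌋-sym x y with x ≟P y | y ≟P x
  ... | yes _ | yes _ = refl
  ... | no _  | no _  = refl
  ... | yes p | no ¬q = ⊥-elim (¬q (≡.sym p))
  ... | no ¬p | yes q = ⊥-elim (¬p (≡.sym q))

  ⌊≟⌋-refl : {a b : ℕ} (x : Fin a ⊎ Fin b) → ⌊ x ≟P x ⌋ ≡ true
  ⌊≟⌋-refl x with x ≟P x
  ... | yes _ = refl
  ... | no ¬p = ⊥-elim (¬p refl)

CompleteMultipartite : (a b : ℕ) → Graph (MPVertex a b)
CompleteMultipartite a b = record
  { E      = λ u v → not ⌊ part u ≟P part v ⌋
  ; sym    = λ u v → ≡.cong not (⌊≟⌋-sym (part u) (part v))
  ; irrefl = λ v → ≡.cong not (⌊≟⌋-refl (part v))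
  }

-- Bipartite tournaments on vertex set Fin n: an orientation of the
-- complete bipartite graph with partite sets side⁻¹(true), side⁻¹(false).
record BipartiteTournament (n : ℕ) : Set₁ where
  field
    side     : Fin n → Bool
    Arc      : Fin n → Fin n → Set
    arc-across : ∀ {u v} → Arc u v → side u ≢ side v
    arc-total  : ∀ u v → side u ≢ side v → Arc u v ⊎ Arc v u
    arc-asym   : ∀ {u v} → Arc u v → Arc v u → ⊥

open BipartiteTournament public

NicheAdj : {n : ℕ} → BipartiteTournament n → Fin n → Fin n → Set
NicheAdj D u v =
  u ≢ v ×
  ((∃ λ w → Arc D u w × Arc D v w) ⊎ (∃ λ w → Arc D w u × Arc D w v))

IsNicheGraphOf : {n : ℕ} → Graph (Fin n) → BipartiteTournament n → Set
IsNicheGraphOf G D = ∀ u v → Adj G u v ⇔ NicheAdj D u v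

NicheRealizable : {n : ℕ} → Graph (Fin n) → Set₁
NicheRealizable {n} G = Σ (BipartiteTournament n) (IsNicheGraphOf G)

-- A niche realisation D of G puts each component of G inside one side of D, since niche edges
-- join vertices on the same side. If both components lie on one side, D has no arcs, so G has no
-- edges and each component is a single vertex. Otherwise D is a Boolean matrix between the two
-- components, and two vertices of one component are adjacent iff their rows agree in some column.
-- Equal rows give the cliques of an expansion, rows equal up to complement give its parts (of at
-- most two cliques), and any two parts are adjacent. A row is determined by its values on one
-- representative of each of the k parts of the other component, and rows of distinct parts are
-- neither equal nor complementary there; normalising by the first column makes them distinct
-- vectors of length k - 1, whence the bound 2^(k-1). Conversely, given a matrix h between the
-- parts of the two expansions whose rows and columns are pairwise neither equal nor
-- complementary, orienting x → y iff h (part x) (part y) xor bit x xor bit y realises G; such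
-- an h is built from a zero row and columns running through the zero vector, the unit vectors
-- and further distinct vectors.
module Submission where

open import Defs
open import Data.Nat using (ℕ; _+_; _*_; _∸_; _^_; _≤_)
open import Data.Bool using (Bool; true; false)
open import Data.Fin using (Fin)
open import Data.Product using (Σ; ∃; _×_)
open import Function.Bundles using (_⇔_)

open import Data.Nat using (zero; suc; _<_; z≤n; s≤s)
import Data.Nat.Properties as ℕ
open import Data.Bool using (not; _xor_; if_then_else_)
open import Data.Bool.Properties
  using (¬-not; not-¬; not-injective; not-involutive; xor-comm; xor-annihilates-not)
  renaming (_≟_ to _≟𝔹_)
open import Data.Fin using (zero; suc; join; splitAt; combine; remQuot; funToFin; finToFun)
import Data.Fin.Properties as Fin
open import Data.Product using (_,_; proj₁; proj₂; swap; map; map₁; map₂)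
open import Data.Product.Properties using (,-injectiveˡ; ,-injectiveʳ)
open import Data.Sum using (_⊎_; inj₁; inj₂; [_,_]′)
open import Data.Sum.Properties using (inj₁-injective; inj₂-injective)
open import Data.Sum.Function.Propositional using (_⊎-⇔_)
open import Data.Empty using (⊥; ⊥-elim)
open import Data.List.Membership.Propositional.Properties using (∈-filter⁺; ∈-tabulate⁺)
open import Data.List.Membership.Setoid.Properties using (index-injective)
open import Data.List.Relation.Unary.Any using (index)
open import Data.Vec.Functional using (_∷_)
open import Function using (_∘_; flip; id; _on_)
open import Function.Bundles using (mk⇔; Equivalence; Inverse)
open import Function.Construct.Composition using (_⇔-∘_)
open import Function.Construct.Identity using (⇔-id)
open import Function.Construct.Symmetry using (⇔-sym)
open import Function.Consequences.Propositional
  using (strictlySurjective⇒surjective; surjective⇒strictlySurjective)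
open import Function.Definitions using (Injective; StrictlySurjective)
open import Relation.Nullary using (¬_; Dec; does; yes; no; contradiction)
open import Relation.Nullary.Decidable
  using (dec-true; dec-false; decidable-stable; ¬?; _×-dec_; _⊎-dec_; _→-dec_)
open import Relation.Unary using (Decidable)
open import Relation.Binary.PropositionalEquality
  using (_≡_; _≢_; refl; trans; cong; cong₂; subst; setoid; module ≡-Reasoning)
import Relation.Binary.PropositionalEquality as ≡
open import Relation.Binary.Structures using (IsEquivalence; IsDecEquivalence)
import Relation.Binary.Construct.On as On
open import Relation.Binary.Construct.Closure.ReflexiveTransitive using (Star; ε; _◅_; fold)
open import Axiom.UniquenessOfIdentityProofs using (module Decidable⇒UIP)

≢-≢⇒≡ : {x y z : Bool} → x ≢ y → y ≢ z → x ≡ z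
≢-≢⇒≡ x≢y y≢z = trans (¬-not x≢y) (≡.sym (¬-not (y≢z ∘ ≡.sym)))

≡⇔≡ : ∀ {A : Set} {a b a' b' : A} → a' ≡ a → b' ≡ b → (a ≡ b) ⇔ (a' ≡ b')
≡⇔≡ refl refl = ⇔-id _

not≡⇔≡ : ∀ {a b a' b'} → a' ≡ not a → b' ≡ not b → (a ≡ b) ⇔ (a' ≡ b')
not≡⇔≡ refl refl = mk⇔ (cong not) not-injective

xor-cancelˡ : ∀ x {a b} → x xor a ≡ x xor b → a ≡ b
xor-cancelˡ false e = e
xor-cancelˡ true  e = not-injective e

xor-cancelʳ : ∀ {a b} x → a xor x ≡ b xor x → a ≡ b
xor-cancelʳ {a} {b} x e = xor-cancelˡ x (trans (xor-comm x a) (trans e (xor-comm b x)))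

xor-≢ : ∀ {x y a b} → x ≢ y → a ≢ b → x xor a ≡ y xor b
xor-≢ {x} {y} {a} {b} x≢y a≢b = begin
  x xor a         ≡⟨ xor-annihilates-not x a ⟨
  not x xor not a ≡⟨ cong₂ _xor_ (¬-not (x≢y ∘ ≡.sym)) (¬-not (a≢b ∘ ≡.sym)) ⟨
  y xor b         ∎
  where open ≡-Reasoning

module _ {a b : ℕ} where

  partIndex : MPVertex a b → Fin (a + b)
  partIndex = join a b ∘ part

  partVertex : Fin (a + b) → MPVertex a b
  partVertex = [ (λ i → inj₁ (i , zero)) , inj₂ ]′ ∘ splitAt a

  partIndex-partVertex : ∀ P → partIndex (partVertex P) ≡ P
  partIndex-partVertex P = trans (cong (join a b) (part-section (splitAt a P))) (Fin.join-splitAt a b P)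
    where
    part-section : ∀ s → part ([ (λ i → inj₁ (i , zero)) , inj₂ ]′ s) ≡ s
    part-section (inj₁ _) = refl
    part-section (inj₂ _) = refl

  partIndex≡⇒part≡ : ∀ {u v} → partIndex u ≡ partIndex v → part u ≡ part v
  partIndex≡⇒part≡ {u} {v} e =
    trans (≡.sym (Fin.splitAt-join a b (part u))) (trans (cong (splitAt a) e) (Fin.splitAt-join a b (part v)))

  bit : MPVertex a b → Bool
  bit (inj₁ (_ , zero))  = false
  bit (inj₁ (_ , suc _)) = true
  bit (inj₂ _)           = false

  part-bit-injective : ∀ {u v} → part u ≡ part v → bit u ≡ bit v → u ≡ v
  part-bit-injective {inj₁ (i , zero)}     {inj₁ (.i , zero)}     refl _  = refl
  part-bit-injective {inj₁ (i , suc zero)} {inj₁ (.i , suc zero)} refl _  = refl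
  part-bit-injective {inj₂ j}              {inj₂ .j}              refl _  = refl
  part-bit-injective {inj₁ (i , zero)}     {inj₁ (.i , suc zero)} refl ()
  part-bit-injective {inj₁ (i , suc zero)} {inj₁ (.i , zero)}     refl ()

  adj⇔part≢ : ∀ u v → Adj (CompleteMultipartite a b) u v ⇔ part u ≢ part v
  adj⇔part≢ u v with part u ≟P part v
  ... | yes p≡ = mk⇔ (λ ()) (λ p≢ → contradiction p≡ p≢)
  ... | no  p≢ = mk⇔ (λ _ → p≢) (λ _ → refl)

  mpVertex⇒1≤ : MPVertex a b → 1 ≤ a + b
  mpVertex⇒1≤ v = ℕ.<-≤-trans (s≤s z≤n) (Fin.toℕ<n (partIndex v))

  mpEnum : Fin (2 * a + b) → MPVertex a b
  mpEnum = [ (λ k → inj₁ (swap (remQuot a k))) , inj₂ ]′ ∘ splitAt (2 * a)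

  mpCode : MPVertex a b → Fin (2 * a + b)
  mpCode (inj₁ (i , t)) = join (2 * a) b (inj₁ (combine t i))
  mpCode (inj₂ j)       = join (2 * a) b (inj₂ j)

  mpCode-mpEnum : ∀ i → mpCode (mpEnum i) ≡ i
  mpCode-mpEnum i with splitAt (2 * a) i in eq
  ... | inj₁ k = trans (cong (join (2 * a) b ∘ inj₁) (Fin.combine-remQuot a k)) (Fin.splitAt⁻¹-↑ˡ eq)
  ... | inj₂ j = Fin.splitAt⁻¹-↑ʳ eq

  surjection⇒2a+b≤ : {X : Set} {N : ℕ} (f : X → MPVertex a b) → StrictlySurjective _≡_ f →
                     (g : X → Fin N) → Injective _≡_ _≡_ g → 2 * a + b ≤ N
  surjection⇒2a+b≤ {X} f f-surj g g-inj = Fin.injective⇒≤ {f = g ∘ section ∘ mpEnum} injective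
    where
    section : MPVertex a b → X
    section v = proj₁ (f-surj v)
    injective : Injective _≡_ _≡_ (g ∘ section ∘ mpEnum)
    injective {i} {j} e = begin
      i                                 ≡⟨ mpCode-mpEnum i ⟨
      mpCode (mpEnum i)                 ≡⟨ cong mpCode (proj₂ (f-surj (mpEnum i))) ⟨
      mpCode (f (section (mpEnum i)))   ≡⟨ cong (mpCode ∘ f) (g-inj e) ⟩
      mpCode (f (section (mpEnum j)))   ≡⟨ cong mpCode (proj₂ (f-surj (mpEnum j))) ⟩
      mpCode (mpEnum j)                 ≡⟨ mpCode-mpEnum j ⟩
      j                                 ∎
      where open ≡-Reasoning

expansion-criterion : {X : Set} (G : Graph X) {a b : ℕ} (f : X → MPVertex a b) →
  StrictlySurjective _≡_ f →
  (∀ x y → x ≢ y → Adj G x y ⇔ (f x ≡ f y ⊎ part (f x) ≢ part (f y))) →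
  IsExpansionOf G (CompleteMultipartite a b)
expansion-criterion G f f-surj adj =
  f , strictlySurjective⇒surjective f-surj ,
  λ x y x≢y → (⇔-id _ ⊎-⇔ ⇔-sym (adj⇔part≢ (f x) (f y))) ⇔-∘ adj x y x≢y

Class : {n : ℕ} → (Fin n → Bool) → Bool → Set
Class {n} c b = Σ (Fin n) λ v → c v ≡ b

class-≡ : ∀ {n} {c : Fin n → Bool} {b} {x y : Class c b} → proj₁ x ≡ proj₁ y → x ≡ y
class-≡ {x = v , p} {.v , q} refl = cong (v ,_) (Decidable⇒UIP.≡-irrelevant _≟𝔹_ p q)

classIndex : ∀ {n} (c : Fin n → Bool) b → Class c b → Fin (classSize c b)
classIndex c b (v , p) = index (∈-filter⁺ (λ v → c v ≟𝔹 b) (∈-tabulate⁺ {f = id} v) p)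

classIndex-injective : ∀ {n} (c : Fin n → Bool) b → Injective _≡_ _≡_ (classIndex c b)
classIndex-injective {n} c b {v , p} {v' , p'} e =
  class-≡ (index-injective (setoid (Fin n)) (∈-filter⁺ (λ v → c v ≟𝔹 b) (∈-tabulate⁺ {f = id} v) p)
                                            (∈-filter⁺ (λ v → c v ≟𝔹 b) (∈-tabulate⁺ {f = id} v') p') e)

ProperRows : {k m : ℕ} → (Fin k → Fin m → Bool) → Set
ProperRows h = ∀ {P P'} → P ≢ P' → (∃ λ Q → h P Q ≡ h P' Q) × (∃ λ Q → h P Q ≢ h P' Q)

ProperMatrix : {k m : ℕ} → (Fin k → Fin m → Bool) → Set
ProperMatrix h = ProperRows h × ProperRows (flip h)

funToFin-cong : ∀ {m n} {f g : Fin m → Fin n} → (∀ i → f i ≡ g i) → funToFin f ≡ funToFin g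
funToFin-cong {zero}  _   = refl
funToFin-cong {suc m} f≗g = cong₂ combine (f≗g zero) (funToFin-cong (f≗g ∘ suc))

module _ {m : ℕ} where
  open Inverse Fin.2↔Bool

  code : (Fin m → Bool) → Fin (2 ^ m)
  code v = funToFin (from ∘ v)

  decode : Fin (2 ^ m) → Fin m → Bool
  decode t = to ∘ finToFun t

  decode-code : ∀ v j → decode (code v) j ≡ v j
  decode-code v j = trans (cong to (Fin.finToFun-funToFin (from ∘ v) j)) (strictlyInverseˡ (v j))

  code-injective : ∀ {v v'} → code v ≡ code v' → ∀ j → v j ≡ v' j
  code-injective {v} {v'} e j =
    trans (≡.sym (decode-code v j)) (trans (cong (λ t → decode t j) e) (decode-code v' j))

  decode-injective : ∀ {t t'} → (∀ j → decode t j ≡ decode t' j) → t ≡ t'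
  decode-injective {t} {t'} e = begin
    t                                 ≡⟨ Fin.funToFin-finToFin {m} {2} t ⟨
    funToFin (finToFun {2} {m} t)     ≡⟨ funToFin-cong {m} (λ j → strictlyInverseʳ (finToFun t j)) ⟨
    funToFin (from ∘ decode t)        ≡⟨ funToFin-cong {m} (cong from ∘ e) ⟩
    funToFin (from ∘ decode t')       ≡⟨ funToFin-cong {m} (λ j → strictlyInverseʳ (finToFun t' j)) ⟩
    funToFin (finToFun {2} {m} t')    ≡⟨ Fin.funToFin-finToFin {m} {2} t' ⟩
    t'                                ∎
    where open ≡-Reasoning

rows-equal-or-complementary : ∀ {k m} (h : Fin k → Fin (suc m) → Bool) {P P'} →
  (∀ j → h P zero xor h P (suc j) ≡ h P' zero xor h P' (suc j)) →
  (∀ Q → h P Q ≡ h P' Q) ⊎ (∀ Q → h P Q ≢ h P' Q)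
rows-equal-or-complementary h {P} {P'} e with h P zero ≟𝔹 h P' zero
... | yes e₀ = inj₁ λ where
  zero    → e₀
  (suc j) → xor-cancelˡ (h P' zero) (trans (cong (_xor h P (suc j)) (≡.sym e₀)) (e j))
... | no ¬e₀ = inj₂ λ where
  zero    → ¬e₀
  (suc j) eq → ¬e₀ (xor-cancelʳ (h P' (suc j)) (trans (cong (h P zero xor_) (≡.sym eq)) (e j)))

properRows⇒≤ : ∀ {k} m (h : Fin k → Fin m → Bool) → ProperRows h → k ≤ 2 ^ (m ∸ 1)
properRows⇒≤ {zero}        _ _ _ = z≤n
properRows⇒≤ {suc zero}    zero _ _ = s≤s z≤n
properRows⇒≤ {suc (suc k)} zero h proper with proper {zero} {suc zero} (λ ())
... | (() , _) , _
properRows⇒≤ {k} (suc m) h proper = Fin.injective⇒≤ {f = code ∘ normalised} injective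
  where
  normalised : Fin k → Fin m → Bool
  normalised P j = h P zero xor h P (suc j)
  injective : Injective _≡_ _≡_ (code ∘ normalised)
  injective {P} {P'} e = decidable-stable (P Fin.≟ P') λ P≢P' →
    [ (λ equal → proj₂ (proj₂ (proper P≢P')) (equal _)) ,
      (λ complementary → complementary _ (proj₂ (proj₁ (proper P≢P')))) ]′
      (rows-equal-or-complementary h (code-injective e))

fresh : ∀ {k N} (e : Fin k → Fin N) → k < N → ∃ λ t → ∀ i → e i ≢ t
fresh {k} {N} e k<N with Fin.any? (λ t → Fin.all? (λ i → ¬? (e i Fin.≟ t)))
... | yes found = found
... | no  none  = contradiction (Fin.injective⇒≤ preimage-injective) (ℕ.<⇒≱ k<N)
  where
  preimage : ∀ t → ∃ λ i → e i ≡ t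
  preimage t = map₂ (decidable-stable (e _ Fin.≟ t))
                    (Fin.¬∀⟶∃¬ k _ (λ i → ¬? (e i Fin.≟ t)) (λ new → none (t , new)))
  preimage-injective : Injective _≡_ _≡_ (proj₁ ∘ preimage)
  preimage-injective {t} {t'} eq =
    trans (≡.sym (proj₂ (preimage t))) (trans (cong e eq) (proj₂ (preimage t')))

∷-injective : ∀ {k N} {t : Fin N} {e : Fin k → Fin N} →
              (∀ i → e i ≢ t) → Injective _≡_ _≡_ e → Injective _≡_ _≡_ (t ∷ e)
∷-injective t-new e-inj {zero}  {zero}   _  = refl
∷-injective t-new e-inj {zero}  {suc i'} eq = contradiction (≡.sym eq) (t-new i')
∷-injective t-new e-inj {suc i} {zero}   eq = contradiction eq (t-new i)
∷-injective t-new e-inj {suc i} {suc i'} eq = cong suc (e-inj eq)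

extend-injection : ∀ {j N} (e : Fin j → Fin N) → Injective _≡_ _≡_ e → ∀ {k} → j ≤ k → k ≤ N →
  ∃ λ (e' : Fin k → Fin N) → Injective _≡_ _≡_ e' × (∀ i → ∃ λ i' → e' i' ≡ e i)
extend-injection e e-inj {zero} z≤n _ = e , e-inj , λ ()
extend-injection e e-inj {suc k} j≤1+k 1+k≤N with ℕ.m≤n⇒m<n∨m≡n j≤1+k
... | inj₂ refl = e , e-inj , λ i → i , refl
... | inj₁ (s≤s j≤k) with extend-injection e e-inj j≤k (ℕ.<⇒≤ 1+k≤N)
...   | e' , e'-inj , covers with fresh e' 1+k≤N
...     | t , t-new = t ∷ e' , ∷-injective t-new e'-inj , λ i → suc (proj₁ (covers i)) , proj₂ (covers i)

-- basis 0 is the zero vector and basis (1 + u) the u-th unit vector.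
basis : ∀ {m} → Fin (suc m) → Fin m → Bool
basis i j = does (suc j Fin.≟ i)

basis-injective : ∀ {m} {i i' : Fin (suc m)} → (∀ j → basis i j ≡ basis i' j) → i ≡ i'
basis-injective {i = i} {i'} e = decidable-stable (i Fin.≟ i') λ i≢i' → separate i i' i≢i' e
  where
  separate : ∀ i i' → i ≢ i' → ¬ (∀ j → basis i j ≡ basis i' j)
  separate (suc j) i' i≢i' e = contradiction
    (trans (≡.sym (dec-true (suc j Fin.≟ suc j) refl)) (trans (e j) (dec-false (suc j Fin.≟ i') i≢i'))) λ ()
  separate zero (suc j) _ e = contradiction (trans (e j) (dec-true (suc j Fin.≟ suc j) refl)) λ ()
  separate zero zero i≢i' _ = i≢i' refl

properMatrix-tall : ∀ m k → suc m ≤ k → k ≤ 2 ^ m → Σ (Fin (suc m) → Fin k → Bool) ProperMatrix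
properMatrix-tall m k m<k k≤2^m = h , proper-rows , proper-columns
  where
  code-basis-injective : Injective _≡_ _≡_ (code ∘ basis)
  code-basis-injective = basis-injective ∘ code-injective

  family : ∃ λ (e : Fin k → Fin (2 ^ m)) → Injective _≡_ _≡_ e × (∀ i → ∃ λ Q → e Q ≡ code (basis i))
  family = extend-injection (code ∘ basis) code-basis-injective m<k k≤2^m

  column : Fin k → Fin (2 ^ m)
  column = proj₁ family

  h : Fin (suc m) → Fin k → Bool
  h zero    Q = false
  h (suc j) Q = decode (column Q) j

  basisColumn : ∀ i → ∃ λ Q → ∀ j → h (suc j) Q ≡ basis i j
  basisColumn i = map₂ (λ eq j → trans (cong (λ t → decode t j) eq) (decode-code (basis i) j))
                       (proj₂ (proj₂ family) i)

  unitColumn : ∀ u → ∃ λ Q → h (suc u) Q ≡ true × (∀ P → P ≢ suc u → h P Q ≡ false)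
  unitColumn u = map₂ (λ col → trans (col u) (dec-true (suc u Fin.≟ suc u) refl) , off col)
                      (basisColumn (suc u))
    where
    off : ∀ {Q} → (∀ j → h (suc j) Q ≡ basis (suc u) j) → ∀ P → P ≢ suc u → h P Q ≡ false
    off col zero    _    = refl
    off col (suc j) P≢Pu = trans (col j) (dec-false (suc j Fin.≟ suc u) P≢Pu)

  proper-rows : ProperRows h
  proper-rows {P} {P'} P≢P' =
    map₂ (λ zeros → trans (zeros P) (≡.sym (zeros P'))) zeroColumn , differ P P' P≢P'
    where
    zeroColumn : ∃ λ Q → ∀ P → h P Q ≡ false
    zeroColumn = map₂ (λ { col zero → refl ; col (suc j) → col j }) (basisColumn zero)
    separated : ∀ u P → P ≢ suc u → ∃ λ Q → h (suc u) Q ≢ h P Q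
    separated u P P≢Pu =
      map₂ (λ { (on , off) eq → contradiction (trans (≡.sym on) (trans eq (off P P≢Pu))) λ () })
           (unitColumn u)
    differ : ∀ P P' → P ≢ P' → ∃ λ Q → h P Q ≢ h P' Q
    differ (suc u) P'      P≢P' = separated u P' (P≢P' ∘ ≡.sym)
    differ zero    (suc u) _    = map₂ (_∘ ≡.sym) (separated u zero λ ())
    differ zero    zero    P≢P' = contradiction refl P≢P'

  proper-columns : ProperRows (flip h)
  proper-columns {Q} {Q'} Q≢Q' = (zero , refl) , map suc id differ
    where
    differ : ∃ λ j → decode (column Q) j ≢ decode (column Q') j
    differ = Fin.¬∀⟶∃¬ m _ (λ j → decode (column Q) j ≟𝔹 decode (column Q') j)
               (Q≢Q' ∘ proj₁ (proj₂ family) ∘ decode-injective)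

transpose : ∀ {k m} → Σ (Fin k → Fin m → Bool) ProperMatrix → Σ (Fin m → Fin k → Bool) ProperMatrix
transpose (h , rows , columns) = flip h , columns , rows

properMatrix : ∀ k₁ k₂ → 1 ≤ k₁ → 1 ≤ k₂ → k₁ ≤ 2 ^ (k₂ ∸ 1) → k₂ ≤ 2 ^ (k₁ ∸ 1) →
               Σ (Fin k₁ → Fin k₂ → Bool) ProperMatrix
properMatrix (suc m₁) (suc m₂) _ _ k₁≤ k₂≤ with ℕ.≤-total (suc m₁) (suc m₂)
... | inj₁ k₁≤k₂ = properMatrix-tall m₁ (suc m₂) k₁≤k₂ k₂≤
... | inj₂ k₂≤k₁ = transpose (properMatrix-tall m₂ (suc m₁) k₂≤k₁ k₁≤)

Antisymmetric : ∀ {n} → (Fin n → Bool) → (Fin n → Fin n → Bool) → Set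
Antisymmetric s W = ∀ {u w} → s u ≢ s w → W w u ≡ not (W u w)

module _ {n : ℕ} (D : BipartiteTournament n) where

  nicheAdj⇒sameSide : ∀ {u v} → NicheAdj D u v → side D u ≡ side D v
  nicheAdj⇒sameSide (_ , inj₁ (w , u→w , v→w)) = ≢-≢⇒≡ (arc-across D u→w) (arc-across D v→w ∘ ≡.sym)
  nicheAdj⇒sameSide (_ , inj₂ (w , w→u , w→v)) = ≢-≢⇒≡ (arc-across D w→u ∘ ≡.sym) (arc-across D w→v)

  Describes : (Fin n → Fin n → Bool) → Set
  Describes W = ∀ {u w} → side D u ≢ side D w → Arc D u w ⇔ W u w ≡ true

  arcIndicator : Fin n → Fin n → Bool
  arcIndicator u w with side D u ≟𝔹 side D w
  ... | yes _  = false
  ... | no  s≢ = [ (λ _ → true) , (λ _ → false) ]′ (arc-total D u w s≢)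

  arcIndicator-describes : Describes arcIndicator
  arcIndicator-describes {u} {w} s≢ with side D u ≟𝔹 side D w
  ... | yes s≡ = contradiction s≡ s≢
  ... | no  s≢′ with arc-total D u w s≢′
  ...   | inj₁ u→w = mk⇔ (λ _ → refl) (λ _ → u→w)
  ...   | inj₂ w→u = mk⇔ (λ u→w → ⊥-elim (arc-asym D u→w w→u)) (λ ())

  module _ {W : Fin n → Fin n → Bool} (describes : Describes W) where

    reverseArc⇔ : ∀ {u w} → side D u ≢ side D w → Arc D w u ⇔ W u w ≡ false
    reverseArc⇔ {u} {w} s≢ = mk⇔ to from
      where
      to : Arc D w u → W u w ≡ false
      to w→u = ¬-not λ W≡true → arc-asym D (Equivalence.from (describes s≢) W≡true) w→u
      from : W u w ≡ false → Arc D w u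
      from W≡false with arc-total D u w s≢
      ... | inj₁ u→w = contradiction (trans (≡.sym (Equivalence.to (describes s≢) u→w)) W≡false) λ ()
      ... | inj₂ w→u = w→u

    describes-antisym : Antisymmetric (side D) W
    describes-antisym {u} {w} s≢ with W u w in eq
    ... | true  = Equivalence.to (reverseArc⇔ (s≢ ∘ ≡.sym)) (Equivalence.from (describes s≢) eq)
    ... | false = Equivalence.to (describes (s≢ ∘ ≡.sym)) (Equivalence.from (reverseArc⇔ s≢) eq)

    nicheAdj⇔ : ∀ {u u'} → side D u ≡ side D u' →
                NicheAdj D u u' ⇔ (u ≢ u' × ∃ λ w → side D u ≢ side D w × W u w ≡ W u' w)
    nicheAdj⇔ {u} {u'} s≡ = mk⇔ to from
      where
      to : NicheAdj D u u' → u ≢ u' × ∃ λ w → side D u ≢ side D w × W u w ≡ W u' w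
      to (u≢u' , inj₁ (w , u→w , u'→w)) =
        u≢u' , w , arc-across D u→w ,
        trans (Equivalence.to (describes (arc-across D u→w)) u→w)
              (≡.sym (Equivalence.to (describes (arc-across D u'→w)) u'→w))
      to (u≢u' , inj₂ (w , w→u , w→u')) =
        u≢u' , w , arc-across D w→u ∘ ≡.sym ,
        trans (Equivalence.to (reverseArc⇔ (arc-across D w→u ∘ ≡.sym)) w→u)
              (≡.sym (Equivalence.to (reverseArc⇔ (arc-across D w→u' ∘ ≡.sym)) w→u'))
      from : u ≢ u' × (∃ λ w → side D u ≢ side D w × W u w ≡ W u' w) → NicheAdj D u u'
      from (u≢u' , w , s≢ , W≡) with W u w in eq
      ... | true  = u≢u' , inj₁ (w , Equivalence.from (describes s≢) eq ,
                                     Equivalence.from (describes (s≢ ∘ trans s≡)) (≡.sym W≡))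
      ... | false = u≢u' , inj₂ (w , Equivalence.from (reverseArc⇔ s≢) eq ,
                                     Equivalence.from (reverseArc⇔ (s≢ ∘ trans s≡)) (≡.sym W≡))

fromWeights : ∀ {n} (s : Fin n → Bool) (W : Fin n → Fin n → Bool) → Antisymmetric s W →
              BipartiteTournament n
fromWeights s W antisym = record
  { side       = s
  ; Arc        = λ u w → s u ≢ s w × W u w ≡ true
  ; arc-across = proj₁
  ; arc-total  = total
  ; arc-asym   = λ (s≢ , u→w) (_ , w→u) →
                   contradiction (trans (≡.sym w→u) (trans (antisym s≢) (cong not u→w))) λ ()
  }
  where
  total : ∀ u w → s u ≢ s w → (s u ≢ s w × W u w ≡ true) ⊎ (s w ≢ s u × W w u ≡ true)
  total u w s≢ with W u w in eq
  ... | true  = inj₁ (s≢ , refl)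
  ... | false = inj₂ (s≢ ∘ ≡.sym , trans (antisym s≢) (cong not eq))

fromWeights-describes : ∀ {n} s W (antisym : Antisymmetric s W) → Describes (fromWeights {n} s W antisym) W
fromWeights-describes s W antisym s≢ = mk⇔ proj₂ (s≢ ,_)

record Quotient {X : Set} (_≈_ : X → X → Set) : Set where
  field
    size             : ℕ
    class            : X → Fin size
    class-surjective : StrictlySurjective _≡_ class
    class-≡⇔         : ∀ x y → class x ≡ class y ⇔ x ≈ y

module QuotientStep {n : ℕ} {P : Fin (suc n) → Set} {_≈_ : Fin (suc n) → Fin (suc n) → Set}
  (≈-equivalence : IsEquivalence _≈_) (Q : Quotient {Σ (Fin n) (P ∘ suc)} ((_≈_ on suc) on proj₁)) where

  open Quotient Q
  open IsEquivalence ≈-equivalence renaming (refl to ≈-refl; sym to ≈-sym; trans to ≈-trans)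

  lift : Σ (Fin n) (P ∘ suc) → Σ (Fin (suc n)) P
  lift (i , p) = suc i , p

  skip : ¬ P zero → Quotient {Σ (Fin (suc n)) P} (_≈_ on proj₁)
  skip ¬p₀ = record
    { size             = size
    ; class            = class′
    ; class-surjective = λ k → map lift id (class-surjective k)
    ; class-≡⇔         = λ where
        (zero , p) _ → contradiction p ¬p₀
        (suc _ , _) (zero , q) → contradiction q ¬p₀
        (suc i , p) (suc j , q) → class-≡⇔ (i , p) (j , q)
    }
    where
    class′ : Σ (Fin (suc n)) P → Fin size
    class′ (zero , p)  = contradiction p ¬p₀
    class′ (suc i , p) = class (i , p)

  merge : ∀ i₀ → P (suc i₀) → zero ≈ suc i₀ → Quotient {Σ (Fin (suc n)) P} (_≈_ on proj₁)
  merge i₀ p₀ z≈i₀ = record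
    { size             = size
    ; class            = class′
    ; class-surjective = λ k → map lift id (class-surjective k)
    ; class-≡⇔         = λ where
        (zero , _)  (zero , _)  → mk⇔ (λ _ → ≈-refl) (λ _ → refl)
        (zero , _)  (suc j , q) → mk⇔ (≈-trans z≈i₀) (≈-trans (≈-sym z≈i₀)) ⇔-∘ class-≡⇔ (i₀ , p₀) (j , q)
        (suc i , p) (zero , _)  → mk⇔ (λ i≈i₀ → ≈-trans i≈i₀ (≈-sym z≈i₀)) (λ i≈z → ≈-trans i≈z z≈i₀)
                                    ⇔-∘ class-≡⇔ (i , p) (i₀ , p₀)
        (suc i , p) (suc j , q) → class-≡⇔ (i , p) (j , q)
    }
    where
    class′ : Σ (Fin (suc n)) P → Fin size
    class′ (zero , _)  = class (i₀ , p₀)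
    class′ (suc i , p) = class (i , p)

  new : P zero → (∀ i → P (suc i) → ¬ zero ≈ suc i) → Quotient {Σ (Fin (suc n)) P} (_≈_ on proj₁)
  new p₀ separate = record
    { size             = suc size
    ; class            = class′
    ; class-surjective = λ where
        zero    → (zero , p₀) , refl
        (suc k) → map lift (cong suc) (class-surjective k)
    ; class-≡⇔         = λ where
        (zero , _)  (zero , _)  → mk⇔ (λ _ → ≈-refl) (λ _ → refl)
        (zero , _)  (suc j , q) → mk⇔ (λ ()) (λ z≈j → contradiction z≈j (separate j q))
        (suc i , p) (zero , _)  → mk⇔ (λ ()) (λ i≈z → contradiction (≈-sym i≈z) (separate i p))
        (suc i , p) (suc j , q) → class-≡⇔ (i , p) (j , q) ⇔-∘ mk⇔ Fin.suc-injective (cong suc)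
    }
    where
    class′ : Σ (Fin (suc n)) P → Fin (suc size)
    class′ (zero , _)  = zero
    class′ (suc i , p) = suc (class (i , p))

quotient : ∀ {n} {P : Fin n → Set} → Decidable P → {_≈_ : Fin n → Fin n → Set} →
           IsDecEquivalence _≈_ → Quotient {Σ (Fin n) P} (_≈_ on proj₁)
quotient {zero} _ _ = record
  { size = 0 ; class = λ () ; class-surjective = λ () ; class-≡⇔ = λ () }
quotient {suc n} {P} P? {_≈_} ≈-dec = step (P? zero) (Fin.any? (λ i → P? (suc i) ×-dec (zero ≈? suc i)))
  where
  open IsDecEquivalence ≈-dec renaming (_≟_ to _≈?_)
  open QuotientStep {P = P} isEquivalence (quotient (P? ∘ suc) (On.isDecEquivalence suc ≈-dec))
  step : Dec (P zero) → Dec (∃ λ i → P (suc i) × zero ≈ suc i) → Quotient (_≈_ on proj₁)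
  step (no ¬p₀) _                        = skip ¬p₀
  step (yes _)  (yes (i₀ , p₀ , z≈i₀)) = merge i₀ p₀ z≈i₀
  step (yes p₀) (no none)                = new p₀ λ i p z≈i → none (i , p , z≈i)

record MultipartiteLabelling {X : Set} (_≈_ _∼_ : X → X → Set) : Set where
  field
    pairs singles    : ℕ
    label            : X → MPVertex pairs singles
    label-surjective : StrictlySurjective _≡_ label
    label-≡⇔         : ∀ x y → label x ≡ label y ⇔ x ≈ y
    part-≡⇔          : ∀ x y → part (label x) ≡ part (label y) ⇔ x ∼ y

module Labelling {n : ℕ} {R : Fin n → Set} (R? : Decidable R) {_≈_ _∼_ : Fin n → Fin n → Set}
  (≈-isDecEquivalence : IsDecEquivalence _≈_) (∼-isDecEquivalence : IsDecEquivalence _∼_)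
  (≈⇒∼ : ∀ {x y} → x ≈ y → x ∼ y)
  (atMostTwo : ∀ {x y z} → x ∼ y → ¬ x ≈ y → y ∼ z → ¬ y ≈ z → x ≈ z) where

  open IsDecEquivalence ≈-isDecEquivalence using ()
    renaming (refl to ≈-refl; sym to ≈-sym; trans to ≈-trans; _≟_ to _≈?_)
  open IsDecEquivalence ∼-isDecEquivalence using ()
    renaming (refl to ∼-refl; sym to ∼-sym; trans to ∼-trans; _≟_ to _∼?_)

  Partnered : Fin n → Set
  Partnered v = ∃ λ u → R u × u ∼ v × ¬ u ≈ v

  partnered? : Decidable Partnered
  partnered? v = Fin.any? (λ u → R? u ×-dec (u ∼? v ×-dec ¬? (u ≈? v)))

  partnered-resp : ∀ {v v'} → R v → v ∼ v' → Partnered v → Partnered v'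
  partnered-resp {v} {v'} r v∼v' (u , r-u , u∼v , u≉v) with u ≈? v'
  ... | no  u≉v' = u , r-u , ∼-trans u∼v v∼v' , u≉v'
  ... | yes u≈v' = v , r , v∼v' , λ v≈v' → u≉v (≈-trans u≈v' (≈-sym v≈v'))

  unpartnered-≈ : ∀ {v v'} → R v' → ¬ Partnered v → v ∼ v' → v ≈ v'
  unpartnered-≈ {v} {v'} r' ¬p v∼v' =
    decidable-stable (v ≈? v') λ v≉v' → ¬p (v' , r' , ∼-sym v∼v' , v≉v' ∘ ≈-sym)

  module Paired   = Quotient (quotient (λ v → R? v ×-dec partnered? v) ∼-isDecEquivalence)
  module Unpaired = Quotient (quotient (λ v → R? v ×-dec ¬? (partnered? v)) ∼-isDecEquivalence)

  leader : Fin Paired.size → Fin n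
  leader k = proj₁ (proj₁ (Paired.class-surjective k))

  leader-∼ : ∀ x → leader (Paired.class x) ∼ proj₁ x
  leader-∼ x = Equivalence.to (Paired.class-≡⇔ _ x) (proj₂ (Paired.class-surjective (Paired.class x)))

  -- Within a part with two vertices, the vertex is read off by comparing with the part's leader.
  orientation : Fin n → Fin n → Fin 2
  orientation v L = if does (v ≈? L) then zero else suc zero

  orientation-≡⇔ : ∀ {v v' L} → v ∼ L → v' ∼ L → orientation v L ≡ orientation v' L ⇔ v ≈ v'
  orientation-≡⇔ {v} {v'} {L} v∼L v'∼L with v ≈? L | v' ≈? L
  ... | yes v≈L | yes v'≈L = mk⇔ (λ _ → ≈-trans v≈L (≈-sym v'≈L)) (λ _ → refl)
  ... | no  v≉L | no  v'≉L = mk⇔ (λ _ → atMostTwo v∼L v≉L (∼-sym v'∼L) (v'≉L ∘ ≈-sym)) (λ _ → refl)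
  ... | yes v≈L | no  v'≉L = mk⇔ (λ ()) (λ v≈v' → contradiction (≈-trans (≈-sym v≈v') v≈L) v'≉L)
  ... | no  v≉L | yes v'≈L = mk⇔ (λ ()) (λ v≈v' → contradiction (≈-trans v≈v' v'≈L) v≉L)

  labelWith : ∀ v → R v → Dec (Partnered v) → MPVertex Paired.size Unpaired.size
  labelWith v r (yes p) = inj₁ (Paired.class (v , r , p) , orientation v (leader (Paired.class (v , r , p))))
  labelWith v r (no ¬p) = inj₂ (Unpaired.class (v , r , ¬p))

  label : Σ (Fin n) R → MPVertex Paired.size Unpaired.size
  label (v , r) = labelWith v r (partnered? v)

  part-≡⇔ : ∀ x y → part (label x) ≡ part (label y) ⇔ proj₁ x ∼ proj₁ y
  part-≡⇔ (v , r) (v' , r') = go (partnered? v) (partnered? v')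
    where
    go : ∀ d d' → part (labelWith v r d) ≡ part (labelWith v' r' d') ⇔ v ∼ v'
    go (yes p) (yes p') = Paired.class-≡⇔ (v , r , p) (v' , r' , p') ⇔-∘ mk⇔ inj₁-injective (cong inj₁)
    go (no ¬p) (no ¬p') = Unpaired.class-≡⇔ (v , r , ¬p) (v' , r' , ¬p') ⇔-∘ mk⇔ inj₂-injective (cong inj₂)
    go (yes p) (no ¬p') = mk⇔ (λ ()) (λ v∼v' → contradiction (partnered-resp r v∼v' p) ¬p')
    go (no ¬p) (yes p') = mk⇔ (λ ()) (λ v∼v' → contradiction (partnered-resp r' (∼-sym v∼v') p') ¬p)

  label-≡⇔ : ∀ x y → label x ≡ label y ⇔ proj₁ x ≈ proj₁ y
  label-≡⇔ (v , r) (v' , r') = go (partnered? v) (partnered? v')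
    where
    go : ∀ d d' → labelWith v r d ≡ labelWith v' r' d' ⇔ v ≈ v'
    go (yes p) (yes p') = mk⇔ to from
      where
      k k' : Fin Paired.size
      k  = Paired.class (v , r , p)
      k' = Paired.class (v' , r' , p')
      class⇔ : k ≡ k' ⇔ v ∼ v'
      class⇔ = Paired.class-≡⇔ (v , r , p) (v' , r' , p')
      orientation⇔ : v ∼ v' → orientation v (leader k) ≡ orientation v' (leader k) ⇔ v ≈ v'
      orientation⇔ v∼v' = orientation-≡⇔ (∼-sym (leader-∼ (v , r , p)))
                                         (∼-sym (∼-trans (leader-∼ (v , r , p)) v∼v'))
      to : labelWith v r (yes p) ≡ labelWith v' r' (yes p') → v ≈ v'
      to eq = Equivalence.to (orientation⇔ v∼v')
                (trans (,-injectiveʳ (inj₁-injective eq)) (cong (orientation v' ∘ leader) (≡.sym k≡k')))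
        where
        k≡k' : k ≡ k'
        k≡k' = ,-injectiveˡ (inj₁-injective eq)
        v∼v' : v ∼ v'
        v∼v' = Equivalence.to class⇔ k≡k'
      from : v ≈ v' → labelWith v r (yes p) ≡ labelWith v' r' (yes p')
      from v≈v' = cong inj₁ (cong₂ _,_ k≡k'
        (trans (Equivalence.from (orientation⇔ (≈⇒∼ v≈v')) v≈v') (cong (orientation v' ∘ leader) k≡k')))
        where
        k≡k' : k ≡ k'
        k≡k' = Equivalence.from class⇔ (≈⇒∼ v≈v')
    go (no ¬p) (no ¬p') = mk⇔ (unpartnered-≈ r' ¬p) ≈⇒∼ ⇔-∘
      (Unpaired.class-≡⇔ (v , r , ¬p) (v' , r' , ¬p') ⇔-∘ mk⇔ inj₂-injective (cong inj₂))
    go (yes p) (no ¬p') = mk⇔ (λ ()) (λ v≈v' → contradiction (partnered-resp r (≈⇒∼ v≈v') p) ¬p')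
    go (no ¬p) (yes p') = mk⇔ (λ ()) (λ v≈v' → contradiction (partnered-resp r' (∼-sym (≈⇒∼ v≈v')) p') ¬p)

  orientation-≈ : ∀ {v L} → v ≈ L → orientation v L ≡ zero
  orientation-≈ {v} {L} v≈L with v ≈? L
  ... | yes _   = refl
  ... | no  v≉L = contradiction v≈L v≉L

  orientation-≉ : ∀ {v L} → ¬ v ≈ L → orientation v L ≡ suc zero
  orientation-≉ {v} {L} v≉L with v ≈? L
  ... | yes v≈L = contradiction v≈L v≉L
  ... | no  _   = refl

  label-paired : ∀ v r (p : Partnered v) →
    label (v , r) ≡ inj₁ (Paired.class (v , r , p) , orientation v (leader (Paired.class (v , r , p))))
  label-paired v r p with partnered? v
  ... | yes p' = cong (λ k → inj₁ (k , orientation v (leader k)))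
                      (Equivalence.from (Paired.class-≡⇔ (v , r , p') (v , r , p)) ∼-refl)
  ... | no ¬p  = contradiction p ¬p

  label-unpaired : ∀ v r (¬p : ¬ Partnered v) → label (v , r) ≡ inj₂ (Unpaired.class (v , r , ¬p))
  label-unpaired v r ¬p with partnered? v
  ... | yes p   = contradiction p ¬p
  ... | no ¬p'  = cong inj₂ (Equivalence.from (Unpaired.class-≡⇔ (v , r , ¬p') (v , r , ¬p)) ∼-refl)

  label-surjective : StrictlySurjective _≡_ label
  label-surjective (inj₂ j) =
    let (v , r , ¬p) , class≡j = Unpaired.class-surjective j
    in (v , r) , trans (label-unpaired v r ¬p) (cong inj₂ class≡j)
  label-surjective (inj₁ (k , t)) = vertex t
    where
    x : Σ (Fin n) λ v → R v × Partnered v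
    x = proj₁ (Paired.class-surjective k)
    L : Fin n
    L = proj₁ x
    r : R L
    r = proj₁ (proj₂ x)
    p : Partnered L
    p = proj₂ (proj₂ x)
    label-in : ∀ y (r-y : R y) (p-y : Partnered y) → y ∼ L → label (y , r-y) ≡ inj₁ (k , orientation y L)
    label-in y r-y p-y y∼L =
      trans (label-paired y r-y p-y) (cong (λ k' → inj₁ (k' , orientation y (leader k')))
        (trans (Equivalence.from (Paired.class-≡⇔ (y , r-y , p-y) x) y∼L)
               (proj₂ (Paired.class-surjective k))))
    vertex : ∀ t → ∃ λ x → label x ≡ inj₁ (k , t)
    vertex zero       = (L , r) , trans (label-in L r p ∼-refl) (cong (inj₁ ∘ (k ,_)) (orientation-≈ ≈-refl))
    vertex (suc zero) = (u , r-u) , trans (label-in u r-u (L , r , ∼-sym u∼L , u≉L ∘ ≈-sym) u∼L)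
                                          (cong (inj₁ ∘ (k ,_)) (orientation-≉ u≉L))
      where
      u : Fin n
      u = proj₁ p
      r-u : R u
      r-u = proj₁ (proj₂ p)
      u∼L : u ∼ L
      u∼L = proj₁ (proj₂ (proj₂ p))
      u≉L : ¬ u ≈ L
      u≉L = proj₂ (proj₂ (proj₂ p))

  labelling : MultipartiteLabelling (_≈_ on proj₁) (_∼_ on proj₁)
  labelling = record
    { pairs = Paired.size ; singles = Unpaired.size ; label = label ; label-surjective = label-surjective
    ; label-≡⇔ = label-≡⇔ ; part-≡⇔ = part-≡⇔ }

module Rows {n : ℕ} (A : Fin n → Fin n → Bool) {C : Fin n → Set} (C? : Decidable C) where

  RowEq RowComp Similar : Fin n → Fin n → Set
  RowEq   u v = ∀ w → C w → A u w ≡ A v w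
  RowComp u v = ∀ w → C w → A u w ≢ A v w
  Similar u v = RowEq u v ⊎ RowComp u v

  rowEq? : ∀ u v → Dec (RowEq u v)
  rowEq? u v = Fin.all? (λ w → C? w →-dec (A u w ≟𝔹 A v w))

  rowComp? : ∀ u v → Dec (RowComp u v)
  rowComp? u v = Fin.all? (λ w → C? w →-dec ¬? (A u w ≟𝔹 A v w))

  rowComp-trans : ∀ {u v t} → RowComp u v → RowComp v t → RowEq u t
  rowComp-trans d d' w c = ≢-≢⇒≡ (d w c) (d' w c)

  rowEq-isDecEquivalence : IsDecEquivalence RowEq
  rowEq-isDecEquivalence = record
    { isEquivalence = record
      { refl  = λ _ _ → refl
      ; sym   = λ e w c → ≡.sym (e w c)
      ; trans = λ e e' w c → trans (e w c) (e' w c)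
      }
    ; _≟_ = rowEq?
    }

  similar-isDecEquivalence : IsDecEquivalence Similar
  similar-isDecEquivalence = record
    { isEquivalence = record { refl = inj₁ (λ _ _ → refl) ; sym = sym′ ; trans = trans′ }
    ; _≟_ = λ u v → rowEq? u v ⊎-dec rowComp? u v
    }
    where
    sym′ : ∀ {u v} → Similar u v → Similar v u
    sym′ (inj₁ e) = inj₁ λ w c → ≡.sym (e w c)
    sym′ (inj₂ d) = inj₂ λ w c → d w c ∘ ≡.sym
    trans′ : ∀ {u v t} → Similar u v → Similar v t → Similar u t
    trans′ (inj₁ e) (inj₁ e') = inj₁ λ w c → trans (e w c) (e' w c)
    trans′ (inj₁ e) (inj₂ d') = inj₂ λ w c eq → d' w c (trans (≡.sym (e w c)) eq)
    trans′ (inj₂ d) (inj₁ e') = inj₂ λ w c eq → d w c (trans eq (≡.sym (e' w c)))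
    trans′ (inj₂ d) (inj₂ d') = inj₁ (rowComp-trans d d')

  ¬∀⇒∃ : ∀ {B : Fin n → Set} → (∀ w → Dec (B w)) → ¬ (∀ w → C w → B w) → ∃ λ w → C w × ¬ B w
  ¬∀⇒∃ B? ¬all with Fin.¬∀⟶∃¬ n _ (λ w → C? w →-dec B? w) ¬all
  ... | w , ¬imp = w , decidable-stable (C? w) (λ ¬c → ¬imp (λ c → contradiction c ¬c)) , λ b → ¬imp (λ _ → b)

  ¬rowEq⇒split : ∀ {u v} → ¬ RowEq u v → ∃ λ w → C w × A u w ≢ A v w
  ¬rowEq⇒split {u} {v} = ¬∀⇒∃ (λ w → A u w ≟𝔹 A v w)

  ¬rowComp⇒meet : ∀ {u v} → ¬ RowComp u v → ∃ λ w → C w × A u w ≡ A v w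
  ¬rowComp⇒meet {u} {v} ¬d = map₂ (map₂ (decidable-stable (_ ≟𝔹 _))) (¬∀⇒∃ (λ w → ¬? (A u w ≟𝔹 A v w)) ¬d)

  meet⇔ : ∃ C → ∀ u v → (∃ λ w → C w × A u w ≡ A v w) ⇔ (RowEq u v ⊎ ¬ Similar u v)
  meet⇔ (w₀ , c₀) u v = mk⇔ to from
    where
    to : (∃ λ w → C w × A u w ≡ A v w) → RowEq u v ⊎ ¬ Similar u v
    to (w , c , eq) with rowEq? u v
    ... | yes e  = inj₁ e
    ... | no  ¬e = inj₂ λ { (inj₁ e) → ¬e e ; (inj₂ d) → d w c eq }
    from : RowEq u v ⊎ ¬ Similar u v → ∃ λ w → C w × A u w ≡ A v w
    from (inj₁ e)    = w₀ , c₀ , e w₀ c₀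
    from (inj₂ ¬sim) = ¬rowComp⇒meet (¬sim ∘ inj₂)

  labelling : ∀ {R : Fin n → Set} → Decidable R →
              MultipartiteLabelling {Σ (Fin n) R} (RowEq on proj₁) (Similar on proj₁)
  labelling R? = Labelling.labelling R? rowEq-isDecEquivalence similar-isDecEquivalence inj₁ atMostTwo
    where
    atMostTwo : ∀ {u v t} → Similar u v → ¬ RowEq u v → Similar v t → ¬ RowEq v t → RowEq u t
    atMostTwo (inj₁ e) ¬e _        _   = contradiction e ¬e
    atMostTwo _        _  (inj₁ e') ¬e' = contradiction e' ¬e'
    atMostTwo (inj₂ d) _  (inj₂ d') _   = rowComp-trans d d'

weight : ∀ {a₁ b₁ a₂ b₂} → (Fin (a₁ + b₁) → Fin (a₂ + b₂) → Bool) → MPVertex a₁ b₁ → MPVertex a₂ b₂ → Bool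
weight h u v = h (partIndex u) (partIndex v) xor (bit u xor bit v)

weight-transpose : ∀ {a₁ b₁ a₂ b₂} (h : Fin (a₁ + b₁) → Fin (a₂ + b₂) → Bool)
                   (u : MPVertex a₁ b₁) (v : MPVertex a₂ b₂) →
                   weight (flip h) v u ≡ weight h u v
weight-transpose h u v = cong (h (partIndex u) (partIndex v) xor_) (xor-comm (bit v) (bit u))

-- Vertices in different parts can be made to agree or to disagree by the choice of v's part;
-- vertices in the same part differ in their bit, hence everywhere.
weight-meet⇔ : ∀ {a₁ b₁ a₂ b₂} (h : Fin (a₁ + b₁) → Fin (a₂ + b₂) → Bool) → ProperRows h →
  MPVertex a₂ b₂ → ∀ u u' → (∃ λ v → weight h u v ≡ weight h u' v) ⇔ (u ≡ u' ⊎ part u ≢ part u')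
weight-meet⇔ {a₁} {b₁} {a₂} {b₂} h proper v₀ u u' = mk⇔ to from
  where
  P P' : Fin (a₁ + b₁)
  P  = partIndex u
  P' = partIndex u'
  at : Fin (a₂ + b₂) → Fin (a₂ + b₂)
  at Q = partIndex (partVertex {a₂} {b₂} Q)
  to : (∃ λ v → weight h u v ≡ weight h u' v) → u ≡ u' ⊎ part u ≢ part u'
  to (v , eq) with part u ≟P part u'
  ... | no  p≢ = inj₂ p≢
  ... | yes p≡ = inj₁ (part-bit-injective p≡ (xor-cancelʳ (bit v) (xor-cancelˡ (h P' (partIndex v)) eq′)))
    where
    eq′ : h P' (partIndex v) xor (bit u xor bit v) ≡ h P' (partIndex v) xor (bit u' xor bit v)
    eq′ = trans (cong (λ p → h (join _ _ p) (partIndex v) xor (bit u xor bit v)) (≡.sym p≡)) eq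
  agree-at : ∀ Q → h P Q ≡ h P' Q → h P (at Q) ≡ h P' (at Q)
  agree-at Q eq rewrite partIndex-partVertex {a₂} {b₂} Q = eq
  differ-at : ∀ Q → h P Q ≢ h P' Q → h P (at Q) ≢ h P' (at Q)
  differ-at Q ne rewrite partIndex-partVertex {a₂} {b₂} Q = ne
  from : u ≡ u' ⊎ part u ≢ part u' → ∃ λ v → weight h u v ≡ weight h u' v
  from (inj₁ refl) = v₀ , refl
  from (inj₂ p≢) with proper (p≢ ∘ partIndex≡⇒part≡ {a₁} {b₁}) | bit u ≟𝔹 bit u'
  ... | (Q , agree) , _  | yes b≡ =
    partVertex Q , cong₂ _xor_ (agree-at Q agree) (cong (_xor bit (partVertex {a₂} Q)) b≡)
  ... | _ , (Q , differ) | no  b≢ =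
    partVertex Q , xor-≢ (differ-at Q differ) (b≢ ∘ xor-cancelʳ (bit (partVertex {a₂} Q)))

expansion-adj⇔weight-meet : {X Y : Set} (GX : Graph X) {a b a' b' : ℕ}
  (h : Fin (a + b) → Fin (a' + b') → Bool) → ProperRows h →
  (ex : IsExpansionOf GX (CompleteMultipartite a b)) →
  (g : Y → MPVertex a' b') → StrictlySurjective _≡_ g → Y →
  ∀ x x' → x ≢ x' → Adj GX x x' ⇔ (∃ λ y → weight h (proj₁ ex x) (g y) ≡ weight h (proj₁ ex x') (g y))
expansion-adj⇔weight-meet GX {a' = a'} {b'} h proper (f , _ , f-adj) g g-surj y₀ x x' x≢x' =
  via-g ⇔-∘ (⇔-sym (weight-meet⇔ h proper (g y₀) (f x) (f x')) ⇔-∘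
             ((⇔-id _ ⊎-⇔ adj⇔part≢ (f x) (f x')) ⇔-∘ f-adj x x' x≢x'))
  where
  Meet : MPVertex a' b' → Set
  Meet v = weight h (f x) v ≡ weight h (f x') v
  via-g : (∃ Meet) ⇔ (∃ λ y → Meet (g y))
  via-g = mk⇔ (λ (v , meet) → map₂ (λ gy≡v → subst Meet (≡.sym gy≡v) meet) (g-surj v))
              (λ (y , meet) → g y , meet)

module Realization {n : ℕ} (G : Graph (Fin n)) (c : Fin n → Bool) (components : TwoComponents G c)
  {a₁ b₁ a₂ b₂ : ℕ} (h : Fin (a₁ + b₁) → Fin (a₂ + b₂) → Bool) (proper : ProperMatrix h)
  (ex₁ : IsExpansionOf (Induced G c true)  (CompleteMultipartite a₁ b₁))
  (ex₂ : IsExpansionOf (Induced G c false) (CompleteMultipartite a₂ b₂)) where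

  f₁ : Class c true → MPVertex a₁ b₁
  f₁ = proj₁ ex₁
  f₂ : Class c false → MPVertex a₂ b₂
  f₂ = proj₁ ex₂

  weightFrom : ∀ u v {bu bv} → c u ≡ bu → c v ≡ bv → Bool
  weightFrom u v {true}  {false} p q = weight h (f₁ (u , p)) (f₂ (v , q))
  weightFrom u v {false} {true}  p q = not (weight h (f₁ (v , q)) (f₂ (u , p)))
  weightFrom u v {true}  {true}  _ _ = false
  weightFrom u v {false} {false} _ _ = false

  W : Fin n → Fin n → Bool
  W u v = weightFrom u v refl refl

  W-≡ : ∀ {u v bu bv} (p : c u ≡ bu) (q : c v ≡ bv) → W u v ≡ weightFrom u v p q
  W-≡ refl refl = refl

  W-antisym : Antisymmetric c W
  W-antisym {u} {v} = go refl refl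
    where
    go : ∀ {bu bv} (p : c u ≡ bu) (q : c v ≡ bv) → bu ≢ bv → weightFrom v u q p ≡ not (weightFrom u v p q)
    go {true}  {false} _ _ _ = refl
    go {false} {true}  _ _ _ = ≡.sym (not-involutive _)
    go {true}  {true}  _ _ b≢ = contradiction refl b≢
    go {false} {false} _ _ b≢ = contradiction refl b≢

  D : BipartiteTournament n
  D = fromWeights c W W-antisym

  rowWeight : ∀ b → Class c b → Class c (not b) → Bool
  rowWeight true  x y = weight h (f₁ x) (f₂ y)
  rowWeight false y x = weight (flip h) (f₂ y) (f₁ x)

  class-adj⇔ : ∀ b (x x' : Class c b) → x ≢ x' →
               Adj (Induced G c b) x x' ⇔ ∃ λ y → rowWeight b x y ≡ rowWeight b x' y
  class-adj⇔ true  = expansion-adj⇔weight-meet (Induced G c true) h (proj₁ proper) ex₁ f₂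
                       (surjective⇒strictlySurjective (proj₁ (proj₂ ex₂))) (proj₁ (proj₂ components false))
  class-adj⇔ false = expansion-adj⇔weight-meet (Induced G c false) (flip h) (proj₂ proper) ex₂ f₁
                       (surjective⇒strictlySurjective (proj₁ (proj₂ ex₁))) (proj₁ (proj₂ components true))

  W-≡⇔ : ∀ b (x x' : Class c b) (y : Class c (not b)) →
         W (proj₁ x) (proj₁ y) ≡ W (proj₁ x') (proj₁ y) ⇔ rowWeight b x y ≡ rowWeight b x' y
  W-≡⇔ true (u , p) (u' , p') (w , q) = ⇔-sym (≡⇔≡ (W-≡ p q) (W-≡ p' q))
  W-≡⇔ false x x' y@(w , p) = ⇔-sym (not≡⇔≡ (flipped x) (flipped x'))
    where
    flipped : ∀ x → W (proj₁ x) w ≡ not (rowWeight false x y)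
    flipped x@(v , q) = trans (W-≡ q p) (cong not (≡.sym (weight-transpose h (f₁ y) (f₂ x))))

  W-meet⇔ : ∀ b (x x' : Class c b) →
    (∃ λ w → c (proj₁ x) ≢ c w × W (proj₁ x) w ≡ W (proj₁ x') w) ⇔ ∃ λ y → rowWeight b x y ≡ rowWeight b x' y
  W-meet⇔ b x x' = mk⇔
    (λ (w , c≢ , eq) → let y = w , trans (¬-not (c≢ ∘ ≡.sym)) (cong not (proj₂ x))
                       in y , Equivalence.to (W-≡⇔ b x x' y) eq)
    (λ (y , eq) → proj₁ y , (λ c≡ → not-¬ refl (trans (≡.sym (proj₂ x)) (trans c≡ (proj₂ y)))) ,
                  Equivalence.from (W-≡⇔ b x x' y) eq)

  isNicheGraph : IsNicheGraphOf G D
  isNicheGraph u v with c u ≟𝔹 c v | u Fin.≟ v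
  ... | no c≢  | _ = mk⇔ (λ adj → contradiction (proj₁ components u v adj) c≢)
                         (λ nadj → contradiction (nicheAdj⇒sameSide D nadj) c≢)
  ... | yes _  | yes refl = mk⇔ (λ adj → contradiction (trans (≡.sym adj) (irrefl G u)) λ ())
                                (λ nadj → contradiction refl (proj₁ nadj))
  ... | yes c≡ | no u≢v =
    ⇔-sym (nicheAdj⇔ D (fromWeights-describes c W W-antisym) c≡) ⇔-∘
    (mk⇔ (u≢v ,_) proj₂ ⇔-∘
    (⇔-sym (W-meet⇔ (c u) (u , refl) (v , ≡.sym c≡)) ⇔-∘
     class-adj⇔ (c u) (u , refl) (v , ≡.sym c≡) (u≢v ∘ cong proj₁)))

  realizable : NicheRealizable G
  realizable = D , isNicheGraph

module _ {X : Set} {_≈_ _∼_ : X → X → Set} (L : MultipartiteLabelling _≈_ _∼_) where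
  open MultipartiteLabelling L

  labelling-expansion : (GX : Graph X) → (∀ x y → x ≢ y → Adj GX x y ⇔ (x ≈ y ⊎ ¬ x ∼ y)) →
                        IsExpansionOf GX (CompleteMultipartite pairs singles)
  labelling-expansion GX adj = expansion-criterion GX label label-surjective λ x y x≢y →
    ⇔-sym (label-≡⇔ x y ⊎-⇔ ¬-⇔ (part-≡⇔ x y)) ⇔-∘ adj x y x≢y
    where
    ¬-⇔ : ∀ {A B : Set} → A ⇔ B → (¬ A) ⇔ (¬ B)
    ¬-⇔ A⇔B = mk⇔ (λ ¬a b → ¬a (Equivalence.from A⇔B b)) (λ ¬b a → ¬b (Equivalence.to A⇔B a))

  representative : Fin (pairs + singles) → X
  representative P = proj₁ (label-surjective (partVertex P))

  partIndex-representative : ∀ P → partIndex (label (representative P)) ≡ P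
  partIndex-representative P =
    trans (cong partIndex (proj₂ (label-surjective (partVertex P)))) (partIndex-partVertex {pairs} P)

  representatives-apart : ∀ {P P'} → P ≢ P' → ¬ representative P ∼ representative P'
  representatives-apart {P} {P'} P≢P' r∼r' = P≢P' (begin
    P                                      ≡⟨ partIndex-representative P ⟨
    partIndex (label (representative P))   ≡⟨ cong (join pairs singles) (Equivalence.from (part-≡⇔ _ _) r∼r') ⟩
    partIndex (label (representative P'))  ≡⟨ partIndex-representative P' ⟩
    P'                                     ∎)
    where open ≡-Reasoning

  representative-∼ : ∀ x → representative (partIndex (label x)) ∼ x
  representative-∼ x = Equivalence.to (part-≡⇔ _ x) (partIndex≡⇒part≡ (partIndex-representative _))

connected-edgeless⇒expansion : {X : Set} (GX : Graph X) → Connected GX → (∀ x y → ¬ Adj GX x y) →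
                               IsExpansionOf GX (CompleteMultipartite 0 1)
connected-edgeless⇒expansion GX (x₀ , walk) edgeless =
  expansion-criterion GX (λ _ → inj₂ zero) (λ { (inj₁ (() , _)) ; (inj₂ zero) → x₀ , refl ; (inj₂ (suc ())) })
    λ x y x≢y → contradiction (singleton (walk x y)) x≢y
  where
  singleton : ∀ {x y} → Star (Adj GX) x y → x ≡ y
  singleton ε               = refl
  singleton (x~y ◅ _) = contradiction x~y (edgeless _ _)

BoundedExpansions : ∀ {n} → Graph (Fin n) → (Fin n → Bool) → ℕ → ℕ → ℕ → ℕ → Set
BoundedExpansions G c a₁ b₁ a₂ b₂ =
  (a₁ + b₁ ≤ 2 ^ (a₂ + b₂ ∸ 1)) × (a₂ + b₂ ≤ 2 ^ (a₁ + b₁ ∸ 1)) ×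
  IsExpansionOf (Induced G c true) (CompleteMultipartite a₁ b₁) ×
  IsExpansionOf (Induced G c false) (CompleteMultipartite a₂ b₂)

module Forward {n : ℕ} (G : Graph (Fin n)) (c : Fin n → Bool) (components : TwoComponents G c)
  (D : BipartiteTournament n) (niche : IsNicheGraphOf G D) where

  inhabitant : ∀ b → Class c b
  inhabitant b = proj₁ (proj₂ components b)

  classSide : Bool → Bool
  classSide b = side D (proj₁ (inhabitant b))

  side-class : ∀ u → side D u ≡ classSide (c u)
  side-class u = fold (λ x y → side D (proj₁ x) ≡ side D (proj₁ y))
                      (λ x~y eq → trans (nicheAdj⇒sameSide D (Equivalence.to (niche _ _) x~y)) eq) refl
                      (proj₂ (proj₂ components (c u)) (u , refl) (inhabitant (c u)))

  oneSided : classSide true ≡ classSide false → ∀ b → IsExpansionOf (Induced G c b) (CompleteMultipartite 0 1)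
  oneSided s≡ b = connected-edgeless⇒expansion (Induced G c b) (proj₂ components b) λ x y adj →
    noArcs (proj₂ (Equivalence.to (niche (proj₁ x) (proj₁ y)) adj))
    where
    classSide-constant : ∀ b b' → classSide b ≡ classSide b'
    classSide-constant true  true  = refl
    classSide-constant false false = refl
    classSide-constant true  false = s≡
    classSide-constant false true  = ≡.sym s≡
    sameSide : ∀ u v → side D u ≡ side D v
    sameSide u v = trans (side-class u) (trans (classSide-constant (c u) (c v)) (≡.sym (side-class v)))
    noArcs : ∀ {u v} → (∃ λ w → Arc D u w × Arc D v w) ⊎ (∃ λ w → Arc D w u × Arc D w v) → ⊥
    noArcs (inj₁ (w , u→w , _)) = arc-across D u→w (sameSide _ w)
    noArcs (inj₂ (w , w→u , _)) = arc-across D w→u (sameSide w _)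

  module TwoSided (s≢ : classSide true ≢ classSide false) where

    classSide-injective : ∀ {b b'} → classSide b ≡ classSide b' → b ≡ b'
    classSide-injective {true}  {true}  _  = refl
    classSide-injective {false} {false} _  = refl
    classSide-injective {true}  {false} s≡ = contradiction s≡ s≢
    classSide-injective {false} {true}  s≡ = contradiction (≡.sym s≡) s≢

    side≢⇔ : ∀ u w → side D u ≢ side D w ⇔ c u ≢ c w
    side≢⇔ u w = mk⇔
      (λ s≢′ c≡ → s≢′ (trans (side-class u) (trans (cong classSide c≡) (≡.sym (side-class w)))))
      (λ c≢ s≡ → c≢ (classSide-injective (trans (≡.sym (side-class u)) (trans s≡ (side-class w)))))

    A : Fin n → Fin n → Bool
    A = arcIndicator D

    module Side (b b' : Bool) where
      open Rows A {C = λ w → c w ≡ b'} (λ w → c w ≟𝔹 b') public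
      L : MultipartiteLabelling {Class c b} (RowEq on proj₁) (Similar on proj₁)
      L = labelling (λ v → c v ≟𝔹 b)
      open MultipartiteLabelling L public

      adj⇔ : b ≢ b' → ∀ (x x' : Class c b) → x ≢ x' →
             Adj (Induced G c b) x x' ⇔ (RowEq (proj₁ x) (proj₁ x') ⊎ ¬ Similar (proj₁ x) (proj₁ x'))
      adj⇔ b≢b' (u , p) (u' , p') x≢x' =
        meet⇔ (inhabitant b') u u' ⇔-∘ (columns ⇔-∘ (mk⇔ proj₂ (u≢u' ,_) ⇔-∘
          (nicheAdj⇔ D (arcIndicator-describes D) sameSide ⇔-∘ niche u u')))
        where
        u≢u' : u ≢ u'
        u≢u' = x≢x' ∘ class-≡
        sameSide : side D u ≡ side D u'
        sameSide = trans (side-class u) (trans (cong classSide (trans p (≡.sym p'))) (≡.sym (side-class u')))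
        other⇔ : ∀ w → side D u ≢ side D w ⇔ c w ≡ b'
        other⇔ w = mk⇔ (λ c≢ → ≢-≢⇒≡ (c≢ ∘ trans p ∘ ≡.sym) b≢b')
                       (λ q c≡ → b≢b' (trans (≡.sym p) (trans c≡ q)))
                   ⇔-∘ side≢⇔ u w
        columns : (∃ λ w → side D u ≢ side D w × A u w ≡ A u' w) ⇔ (∃ λ w → c w ≡ b' × A u w ≡ A u' w)
        columns = mk⇔ (map₂ (map₁ (Equivalence.to (other⇔ _)))) (map₂ (map₁ (Equivalence.from (other⇔ _))))

      expansion : b ≢ b' → IsExpansionOf (Induced G c b) (CompleteMultipartite pairs singles)
      expansion b≢b' = labelling-expansion L (Induced G c b) (adj⇔ b≢b')

    module Bound (b b' : Bool) (b≢b' : b ≢ b') where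
      module R = Side b b'
      module C = Side b' b

      A-flip : ∀ {x w} → c x ≡ b → c w ≡ b' → A x w ≡ not (A w x)
      A-flip {x} {w} p q = describes-antisym D (arcIndicator-describes D)
        (Equivalence.from (side≢⇔ w x) λ c≡ → b≢b' (trans (≡.sym p) (trans (≡.sym c≡) q)))

      transfer : ∀ {w w'} → c w ≡ b' → c w' ≡ b' → C.Similar w' w →
                 (∀ {x} → c x ≡ b → A x w' ≡ A x w) ⊎ (∀ {x} → c x ≡ b → A x w' ≡ not (A x w))
      transfer {w} {w'} q q' (inj₁ e) = inj₁ λ {x} p →
        trans (A-flip p q') (trans (cong not (e x p)) (≡.sym (A-flip p q)))
      transfer {w} {w'} q q' (inj₂ d) = inj₂ λ {x} p →
        trans (A-flip p q') (trans (cong not (¬-not (d x p))) (cong not (≡.sym (A-flip p q))))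

      rowVertex : Fin (R.pairs + R.singles) → Class c b
      rowVertex = representative R.L

      columnVertex : Fin (C.pairs + C.singles) → Class c b'
      columnVertex = representative C.L

      columnOf : Class c b' → Fin (C.pairs + C.singles)
      columnOf y = partIndex (C.label y)

      columnRepresentative : Class c b' → Fin n
      columnRepresentative y = proj₁ (columnVertex (columnOf y))

      column-agreement⇔ : ∀ (y : Class c b') {x x'} → c x ≡ b → c x' ≡ b →
        (A x (proj₁ y) ≡ A x' (proj₁ y)) ⇔ (A x (columnRepresentative y) ≡ A x' (columnRepresentative y))
      column-agreement⇔ y p p' =
        [ (λ same → ≡⇔≡ (same p) (same p')) , (λ opposite → not≡⇔≡ (opposite p) (opposite p')) ]′
          (transfer (proj₂ y) (proj₂ (columnVertex (columnOf y))) (representative-∼ C.L y))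

      h : Fin (R.pairs + R.singles) → Fin (C.pairs + C.singles) → Bool
      h P Q = A (proj₁ (rowVertex P)) (proj₁ (columnVertex Q))

      proper : ProperRows h
      proper {P} {P'} P≢P' = agree , differ
        where
        x x' : Class c b
        x  = rowVertex P
        x' = rowVertex P'
        apart : ¬ R.Similar (proj₁ x) (proj₁ x')
        apart = representatives-apart R.L P≢P'
        agreement⇔ : ∀ y →
          (A (proj₁ x) (proj₁ y) ≡ A (proj₁ x') (proj₁ y)) ⇔ (h P (columnOf y) ≡ h P' (columnOf y))
        agreement⇔ y = column-agreement⇔ y (proj₂ x) (proj₂ x')
        agree : ∃ λ Q → h P Q ≡ h P' Q
        agree = let (w , q , eq) = R.¬rowComp⇒meet (apart ∘ inj₂)
                in columnOf (w , q) , Equivalence.to (agreement⇔ (w , q)) eq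
        differ : ∃ λ Q → h P Q ≢ h P' Q
        differ = let (w , q , ne) = R.¬rowEq⇒split (apart ∘ inj₁)
                 in columnOf (w , q) , ne ∘ Equivalence.from (agreement⇔ (w , q))

      bound : R.pairs + R.singles ≤ 2 ^ (C.pairs + C.singles ∸ 1)
      bound = properRows⇒≤ _ h proper

  boundedExpansions : ∃ λ a₁ → ∃ λ b₁ → ∃ λ a₂ → ∃ λ b₂ → BoundedExpansions G c a₁ b₁ a₂ b₂
  boundedExpansions with classSide true ≟𝔹 classSide false
  ... | yes s≡ = 0 , 1 , 0 , 1 , s≤s z≤n , s≤s z≤n , oneSided s≡ true , oneSided s≡ false
  ... | no  s≢ = Side.pairs true false , Side.singles true false ,
                 Side.pairs false true , Side.singles false true ,
                 Bound.bound true false (λ ()) , Bound.bound false true (λ ()) ,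
                 Side.expansion true false (λ ()) , Side.expansion false true (λ ())
    where open TwoSided s≢

expansion⇒2a+b≤ : ∀ {n} (G : Graph (Fin n)) c b {a₀ b₀} →
  IsExpansionOf (Induced G c b) (CompleteMultipartite a₀ b₀) → 2 * a₀ + b₀ ≤ classSize c b
expansion⇒2a+b≤ G c b (f , f-surj , _) =
  surjection⇒2a+b≤ f (surjective⇒strictlySurjective f-surj) (classIndex c b) (classIndex-injective c b)

ExpansionConditions : ∀ {n} → Graph (Fin n) → (Fin n → Bool) → Set
ExpansionConditions G c =
  ∃ λ a₁ → ∃ λ b₁ → ∃ λ a₂ → ∃ λ b₂ →
    (2 * a₁ + b₁ ≤ classSize c true) × (2 * a₂ + b₂ ≤ classSize c false) ×
    (1 ≤ a₁ + b₁) × (a₁ + b₁ ≤ 2 ^ (a₂ + b₂ ∸ 1)) ×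
    (1 ≤ a₂ + b₂) × (a₂ + b₂ ≤ 2 ^ (a₁ + b₁ ∸ 1)) ×
    IsExpansionOf (Induced G c true) (CompleteMultipartite a₁ b₁) ×
    IsExpansionOf (Induced G c false) (CompleteMultipartite a₂ b₂)

theorem3p6 : (n : ℕ) (G : Graph (Fin n)) (c : Fin n → Bool) →
    TwoComponents G c →
    (NicheRealizable G ⇔
      (∃ λ a₁ → ∃ λ b₁ → ∃ λ a₂ → ∃ λ b₂ →
        (2 * a₁ + b₁ ≤ classSize c true) ×
        (2 * a₂ + b₂ ≤ classSize c false) ×
        (1 ≤ a₁ + b₁) × (a₁ + b₁ ≤ 2 ^ (a₂ + b₂ ∸ 1)) ×
        (1 ≤ a₂ + b₂) × (a₂ + b₂ ≤ 2 ^ (a₁ + b₁ ∸ 1)) ×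
        IsExpansionOf (Induced G c true) (CompleteMultipartite a₁ b₁) ×
        IsExpansionOf (Induced G c false) (CompleteMultipartite a₂ b₂)))
theorem3p6 n G c components = mk⇔ necessary sufficient
  where
  nonempty : ∀ {b a₀ b₀} → IsExpansionOf (Induced G c b) (CompleteMultipartite a₀ b₀) → 1 ≤ a₀ + b₀
  nonempty {b} (f , _) = mpVertex⇒1≤ (f (proj₁ (proj₂ components b)))

  necessary : NicheRealizable G → ExpansionConditions G c
  necessary (D , niche) with Forward.boundedExpansions G c components D niche
  ... | a₁ , b₁ , a₂ , b₂ , bound₁ , bound₂ , ex₁ , ex₂ =
    a₁ , b₁ , a₂ , b₂ , expansion⇒2a+b≤ G c true ex₁ , expansion⇒2a+b≤ G c false ex₂ ,
    nonempty ex₁ , bound₁ , nonempty ex₂ , bound₂ , ex₁ , ex₂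

  sufficient : ExpansionConditions G c → NicheRealizable G
  sufficient (a₁ , b₁ , a₂ , b₂ , _ , _ , 1≤k₁ , bound₁ , 1≤k₂ , bound₂ , ex₁ , ex₂) =
    let h , proper = properMatrix (a₁ + b₁) (a₂ + b₂) 1≤k₁ 1≤k₂ bound₁ bound₂
    in Realization.realizable G c components h proper ex₁ ex₂
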